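{- Let $q\ge2$ be a prime power. For $n\ge1$ let $I_n$ denote the number of monic irreducible polynomials of degree $n$ in $\mathbb{F}_q[X]$ with nonzero constant term (so $I_1=q-1$ and $I_n=\frac1n\sum_{d\mid n}\mu(d)q^{n/d}$ for $n\ge2$, where $\mu$ is the Möbius function). Then $I_n$ is a non-decreasing function of $n\ge1$, i.e. $I_n\ge I_{n-1}$ for all $n\ge2$. -}

module Defs where

open import Data.Nat as ℕ using (ℕ; zero; suc; _≤_; _*_; _^_)
open import Data.Nat.Divisibility using (_∣_; _∣?_)
open import Data.Nat.DivMod using (_/_)
open import Data.Nat.Primality using (Prime)
open import Data.Integer as ℤ using (ℤ; +_; -_)
open import Data.Integer.DivMod using () renaming (_/_ to _div_)
open import Data.List using (List; []; _∷_; map; foldr; upTo)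
open import Data.Product using (∃₂; _×_)
open import Relation.Nullary using (yes; no)
open import Relation.Binary.PropositionalEquality using (_≡_)

IsPrimePower : ℕ → Set
IsPrimePower q = ∃₂ λ p k → Prime p × 1 ≤ k × q ≡ p ^ k

-- Möbius function by trial division.
-- mobAux fuel n c : trial divisors 2 + c, 2 + c + 1, ... ; fuel n suffices.
mobAux : ℕ → ℕ → ℕ → ℤ
mobAux zero    n c = + 1
mobAux (suc f) zero c = + 0          -- μ is only used on n ≥ 1
mobAux (suc f) (suc zero) c = + 1
mobAux (suc f) n@(suc (suc _)) c with (2 ℕ.+ c) ∣? n
... | no _  = mobAux f n (suc c)
... | yes _ with ((2 ℕ.+ c) * (2 ℕ.+ c)) ∣? n
...   | yes _ = + 0
...   | no _  = - mobAux f (n / (2 ℕ.+ c)) (suc c)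

μ : ℕ → ℤ
μ n = mobAux n n 0

sumDiv : ℕ → (ℕ → ℤ) → ℤ
sumDiv n f = foldr (λ i acc → term (suc i) ℤ.+ acc) (+ 0) (upTo n)
  where
  term : ℕ → ℤ
  term d with d ∣? n
  ... | yes _ = f d
  ... | no _  = + 0

I : ℕ → ℕ → ℤ
I q zero = + 0
I q (suc zero) = + q ℤ.- + 1
I q n@(suc (suc m)) =
  sumDiv n (λ d → μ d ℤ.* (+ (q ^ (quot n d)))) div (+ n)
  where
  quot : ℕ → ℕ → ℕ
  quot a zero = 0
  quot a (suc b) = a / suc b

module Submission where

-- With S_n = Σ_{d ∣ n} μ(d) q^{n/d} (mobiusSum q n), so that I_n = ⌊S_n / n⌋ for n ≥ 2,
-- the term d = 1 of S_n is q^n and each of the other n − 1 terms has absolute value at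
-- most q^⌊n/2⌋. Hence ⌊S_n / n⌋ ≤ ⌊S_{n+1} / (n+1)⌋ as soon as
--   (n+1)(q^n + (n−1) q^⌊n/2⌋) + n · n q^⌈n/2⌉ ≤ n q^{n+1},
-- which holds for every n ≥ 1 when q ≥ 3 and for n ≥ 10 when q = 2. The remaining cases
-- q = 2, 2 ≤ n ≤ 9 are checked by evaluation, and I_1 = q − 1 ≤ (q² − q)/2 = I_2.

open import Defs
open import Data.Nat using (ℕ; suc; _≤_)
open import Data.Integer using () renaming (_≤_ to _≤ℤ_)
open import Data.Nat as ℕ using (zero; _+_; _*_; _^_; z≤n; s≤s; ⌊_/2⌋; ⌈_/2⌉)
import Data.Nat.Properties as ℕ
open import Data.Nat.Divisibility using (_∣?_; 1∣_)
open import Data.Nat.DivMod using (_/_; n/1≡n; /-monoʳ-≤; m/n≡1+[m∸n]/n)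
open import Data.Nat.Primality using (prime⇒nonZero; prime⇒nonTrivial)
open import Data.Nat.Tactic.RingSolver using (solve)
open import Data.Integer as ℤ using (ℤ; +_; ∣_∣; -≤+; +≤+)
import Data.Integer.Properties as ℤ
open import Data.Integer.DivMod using (_/ℕ_; [n/d]*d≤n; n<s[n/ℕd]*d; div-pos-is-/ℕ) renaming (_/_ to _div_)
import Data.Integer.Tactic.RingSolver as ℤ-Solver
open import Data.List using (_∷_; []; foldr; upTo; applyUpTo; length)
open import Data.List.Properties using (foldr-cong; length-applyUpTo)
open import Data.List.Relation.Unary.All as All using (All)
open import Data.List.Relation.Unary.All.Properties using (applyUpTo⁺₂)
open import Data.Product using (_,_)
open import Relation.Nullary using (yes; no; contradiction)
open import Relation.Nullary.Decidable using (True; toWitness)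
open import Relation.Binary.PropositionalEquality

i≤∣i∣ : ∀ i → i ≤ℤ + ∣ i ∣
i≤∣i∣ (+ n)      = ℤ.≤-refl
i≤∣i∣ ℤ.-[1+ n ] = -≤+

∣i-j∣≤k⇒i≤j+k : ∀ i j {k} → ∣ i ℤ.- j ∣ ≤ k → i ≤ℤ j ℤ.+ + k
∣i-j∣≤k⇒i≤j+k i j {k} h = begin
  i               ≡⟨ ℤ-Solver.solve (i ∷ j ∷ []) ⟩
  j ℤ.+ (i ℤ.- j) ≤⟨ ℤ.+-monoʳ-≤ j (ℤ.≤-trans (i≤∣i∣ (i ℤ.- j)) (+≤+ h)) ⟩
  j ℤ.+ + k       ∎
  where open ℤ.≤-Reasoning

∣i-j∣≤k⇒j≤i+k : ∀ i j {k} → ∣ i ℤ.- j ∣ ≤ k → j ≤ℤ i ℤ.+ + k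
∣i-j∣≤k⇒j≤i+k i j h = ∣i-j∣≤k⇒i≤j+k j i (subst (_≤ _) (ℤ.∣i-j∣≡∣j-i∣ i j) h)

+-cancelʳ-≤ : ∀ {i j} k → i ℤ.+ k ≤ℤ j ℤ.+ k → i ≤ℤ j
+-cancelʳ-≤ {i} {j} k h = begin
  i                   ≡⟨ ℤ-Solver.solve (i ∷ k ∷ []) ⟩
  i ℤ.+ k ℤ.- k       ≤⟨ ℤ.+-monoˡ-≤ (ℤ.- k) h ⟩
  j ℤ.+ k ℤ.- k       ≡⟨ ℤ-Solver.solve (j ∷ k ∷ []) ⟩
  j                   ∎
  where open ℤ.≤-Reasoning

i*d≤j⇒i≤j/d : ∀ d .{{_ : ℕ.NonZero d}} {i j} → i ℤ.* + d ≤ℤ j → i ≤ℤ j div + d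
i*d≤j⇒i≤j/d d {i} {j} h = subst (i ≤ℤ_) (sym (div-pos-is-/ℕ j d)) (begin
  i                           ≡⟨ ℤ.pred-suc i ⟨
  ℤ.pred (ℤ.suc i)             ≤⟨ ℤ.pred-mono (ℤ.i<j⇒suc[i]≤j i<1+j/d) ⟩
  ℤ.pred (ℤ.suc (j /ℕ d))     ≡⟨ ℤ.pred-suc (j /ℕ d) ⟩
  j /ℕ d                      ∎)
  where
  open ℤ.≤-Reasoning
  i<1+j/d : i ℤ.< ℤ.suc (j /ℕ d)
  i<1+j/d = ℤ.*-cancelʳ-<-nonNeg (+ d) (ℤ.≤-<-trans h (n<s[n/ℕd]*d j d))

div≤div-suc : ∀ n .{{_ : ℕ.NonZero n}} A B → + suc n ℤ.* A ≤ℤ + n ℤ.* B → A div + n ≤ℤ B div + suc n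
div≤div-suc n@(suc _) A B h = i*d≤j⇒i≤j/d (suc n) (ℤ.*-cancelˡ-≤-pos _ _ (+ n) (begin
  + n ℤ.* (x ℤ.* + suc n)   ≡⟨ commute (+ n) (+ suc n) x ⟩
  + suc n ℤ.* (x ℤ.* + n)   ≤⟨ ℤ.*-monoˡ-≤-nonNeg (+ suc n) ([n/d]*d≤n A (+ n)) ⟩
  + suc n ℤ.* A             ≤⟨ h ⟩
  + n ℤ.* B                 ∎))
  where
  open ℤ.≤-Reasoning
  x = A div + n
  commute : ∀ a b y → a ℤ.* (y ℤ.* b) ≡ b ℤ.* (y ℤ.* a)
  commute = ℤ-Solver.solve-∀

cross-≤-from-estimates : ∀ n A B x y {e f} → ∣ A ℤ.- + x ∣ ≤ e → ∣ B ℤ.- + y ∣ ≤ f →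
                   suc n * (x + e) + n * f ≤ n * y → + suc n ℤ.* A ≤ℤ + n ℤ.* B
cross-≤-from-estimates n A B x y {e} {f} A≈x B≈y h = +-cancelʳ-≤ (+ n ℤ.* + f) (begin
  + suc n ℤ.* A ℤ.+ + n ℤ.* + f
    ≤⟨ ℤ.+-monoˡ-≤ (+ n ℤ.* + f) (ℤ.*-monoˡ-≤-nonNeg (+ suc n) (∣i-j∣≤k⇒i≤j+k A (+ x) A≈x)) ⟩
  + suc n ℤ.* (+ x ℤ.+ + e) ℤ.+ + n ℤ.* + f  ≡⟨ cast ⟨
  + (suc n * (x + e) + n * f)                ≤⟨ +≤+ h ⟩
  + (n * y)                                  ≡⟨ ℤ.pos-* n y ⟩
  + n ℤ.* + y                                ≤⟨ ℤ.*-monoˡ-≤-nonNeg (+ n) (∣i-j∣≤k⇒j≤i+k B (+ y) B≈y) ⟩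
  + n ℤ.* (B ℤ.+ + f)                        ≡⟨ ℤ.*-distribˡ-+ (+ n) B (+ f) ⟩
  + n ℤ.* B ℤ.+ + n ℤ.* + f                  ∎)
  where
  open ℤ.≤-Reasoning
  cast : + (suc n * (x + e) + n * f) ≡ + suc n ℤ.* (+ x ℤ.+ + e) ℤ.+ + n ℤ.* + f
  cast = trans (ℤ.pos-+ (suc n * (x + e)) (n * f))
               (cong₂ ℤ._+_ (trans (ℤ.pos-* (suc n) (x + e)) (cong (+ suc n ℤ.*_) (ℤ.pos-+ x e)))
                            (ℤ.pos-* n f))

divisorTerm : ℕ → (ℕ → ℤ) → ℕ → ℤ
divisorTerm n f d with d ∣? n
... | yes _ = f d
... | no  _ = + 0

-- The divisor test inside sumDiv is local to Defs and cannot be named, so the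
-- left-hand side of sumDiv-step≡ is left to unification with its use.
mutual
  sumDiv≡foldr : ∀ n f → sumDiv n f ≡ foldr (λ i acc → divisorTerm n f (suc i) ℤ.+ acc) (+ 0) (upTo n)
  sumDiv≡foldr n f = foldr-cong (sumDiv-step≡ n f) refl (upTo n)

  sumDiv-step≡ : ∀ n f i acc → _ ≡ divisorTerm n f (suc i) ℤ.+ acc
  sumDiv-step≡ n f i acc with suc i ∣? n
  ... | yes _ = refl
  ... | no  _ = refl

divisorTerm-cong : ∀ n {f g} d → f d ≡ g d → divisorTerm n f d ≡ divisorTerm n g d
divisorTerm-cong n d f≡g with d ∣? n
... | yes _ = f≡g
... | no  _ = refl

divisorTerm-1 : ∀ n f → divisorTerm n f 1 ≡ f 1
divisorTerm-1 n f with 1 ∣? n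
... | yes _  = refl
... | no 1∤n = contradiction (1∣ n) 1∤n

∣divisorTerm∣≤ : ∀ n f d {c} → ∣ f d ∣ ≤ c → ∣ divisorTerm n f d ∣ ≤ c
∣divisorTerm∣≤ n f d h with d ∣? n
... | yes _ = h
... | no  _ = z≤n

sumDiv-cong : ∀ n {f g} → (∀ d → f (suc d) ≡ g (suc d)) → sumDiv n f ≡ sumDiv n g
sumDiv-cong n {f} {g} f≗g = begin
  sumDiv n f                                                     ≡⟨ sumDiv≡foldr n f ⟩
  foldr (λ i acc → divisorTerm n f (suc i) ℤ.+ acc) (+ 0) (upTo n)
    ≡⟨ foldr-cong (λ i acc → cong (ℤ._+ acc) (divisorTerm-cong n (suc i) (f≗g i))) refl (upTo n) ⟩
  foldr (λ i acc → divisorTerm n g (suc i) ℤ.+ acc) (+ 0) (upTo n) ≡⟨ sumDiv≡foldr n g ⟨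
  sumDiv n g                                                     ∎
  where open ≡-Reasoning

∣foldr-+∣≤length* : ∀ {A : Set} (g : A → ℤ) {c xs} → All (λ x → ∣ g x ∣ ≤ c) xs →
                    ∣ foldr (λ x acc → g x ℤ.+ acc) (+ 0) xs ∣ ≤ length xs * c
∣foldr-+∣≤length* g All.[]         = z≤n
∣foldr-+∣≤length* g {xs = x ∷ xs} (h All.∷ hs) =
  ℕ.≤-trans (ℤ.∣i+j∣≤∣i∣+∣j∣ (g x) (foldr (λ x acc → g x ℤ.+ acc) (+ 0) xs))
            (ℕ.+-mono-≤ h (∣foldr-+∣≤length* g hs))

sumDiv-dominated : ∀ k f {c} → (∀ d → ∣ f (2 + d) ∣ ≤ c) → ∣ sumDiv (suc k) f ℤ.- f 1 ∣ ≤ k * c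
sumDiv-dominated k f {c} bound = begin
  ∣ sumDiv (suc k) f ℤ.- f 1 ∣                  ≡⟨ cong (λ s → ∣ s ℤ.- f 1 ∣) (sumDiv≡foldr (suc k) f) ⟩
  ∣ divisorTerm (suc k) f 1 ℤ.+ rest ℤ.- f 1 ∣  ≡⟨ cong (λ t → ∣ t ℤ.+ rest ℤ.- f 1 ∣) (divisorTerm-1 (suc k) f) ⟩
  ∣ f 1 ℤ.+ rest ℤ.- f 1 ∣                      ≡⟨ cong ∣_∣ (cancel (f 1) rest) ⟩
  ∣ rest ∣                                      ≤⟨ ∣foldr-+∣≤length* term (applyUpTo⁺₂ suc k term-bound) ⟩
  length (applyUpTo suc k) * c                  ≡⟨ cong (_* c) (length-applyUpTo suc k) ⟩
  k * c                                         ∎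
  where
  open ℕ.≤-Reasoning
  term : ℕ → ℤ
  term i = divisorTerm (suc k) f (suc i)
  term-bound : ∀ d → ∣ term (suc d) ∣ ≤ c
  term-bound d = ∣divisorTerm∣≤ (suc k) f (2 + d) (bound d)
  rest = foldr (λ i acc → term i ℤ.+ acc) (+ 0) (applyUpTo suc k)
  cancel : ∀ a r → a ℤ.+ r ℤ.- a ≡ r
  cancel = ℤ-Solver.solve-∀

∣mobAux∣≤1 : ∀ fuel n c → ∣ mobAux fuel n c ∣ ≤ 1
∣mobAux∣≤1 zero          n               c = ℕ.≤-refl
∣mobAux∣≤1 (suc fuel)    zero            c = z≤n
∣mobAux∣≤1 (suc fuel)    (suc zero)      c = ℕ.≤-refl
∣mobAux∣≤1 (suc fuel) n@(suc (suc _))    c with (2 + c) ∣? n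
... | no  _ = ∣mobAux∣≤1 fuel n (suc c)
... | yes _ with (2 + c) * (2 + c) ∣? n
...   | yes _ = z≤n
...   | no  _ = subst (_≤ 1) (sym (ℤ.∣-i∣≡∣i∣ (mobAux fuel (n / (2 + c)) (suc c))))
                      (∣mobAux∣≤1 fuel (n / (2 + c)) (suc c))

∣μ∣≤1 : ∀ n → ∣ μ n ∣ ≤ 1
∣μ∣≤1 n = ∣mobAux∣≤1 n n 0

n/2≡⌊n/2⌋ : ∀ n → n / 2 ≡ ⌊ n /2⌋
n/2≡⌊n/2⌋ 0             = refl
n/2≡⌊n/2⌋ 1             = refl
n/2≡⌊n/2⌋ (suc (suc n)) = trans (m/n≡1+[m∸n]/n {suc (suc n)} (s≤s (s≤s z≤n))) (cong suc (n/2≡⌊n/2⌋ n))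

mobiusTerm : ℕ → ℕ → ℕ → ℤ
mobiusTerm q n zero    = + 0
mobiusTerm q n (suc d) = μ (suc d) ℤ.* + (q ^ (n / suc d))

mobiusSum : ℕ → ℕ → ℤ
mobiusSum q n = sumDiv n (mobiusTerm q n)

I≡mobiusSum/n : ∀ q k → I q (2 + k) ≡ mobiusSum q (2 + k) div + (2 + k)
I≡mobiusSum/n q k = cong (_div + (2 + k)) (sumDiv-cong (2 + k) (λ _ → refl))

mobiusTerm-1 : ∀ q n → mobiusTerm q n 1 ≡ + (q ^ n)
mobiusTerm-1 q n = trans (ℤ.*-identityˡ (+ (q ^ (n / 1)))) (cong (λ e → + (q ^ e)) (n/1≡n n))

∣mobiusTerm∣≤q^⌊n/2⌋ : ∀ q .{{_ : ℕ.NonZero q}} n d → ∣ mobiusTerm q n (2 + d) ∣ ≤ q ^ ⌊ n /2⌋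
∣mobiusTerm∣≤q^⌊n/2⌋ q n d = begin
  ∣ μ (2 + d) ℤ.* + (q ^ (n / (2 + d))) ∣  ≡⟨ ℤ.abs-* (μ (2 + d)) (+ (q ^ (n / (2 + d)))) ⟩
  ∣ μ (2 + d) ∣ * q ^ (n / (2 + d))        ≤⟨ ℕ.*-monoˡ-≤ (q ^ (n / (2 + d))) (∣μ∣≤1 (2 + d)) ⟩
  1 * q ^ (n / (2 + d))                    ≡⟨ ℕ.*-identityˡ (q ^ (n / (2 + d))) ⟩
  q ^ (n / (2 + d))                        ≤⟨ ℕ.^-monoʳ-≤ q (/-monoʳ-≤ n (ℕ.m≤m+n 2 d)) ⟩
  q ^ (n / 2)                              ≡⟨ cong (q ^_) (n/2≡⌊n/2⌋ n) ⟩
  q ^ ⌊ n /2⌋                              ∎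
  where open ℕ.≤-Reasoning

mobiusSum-estimate : ∀ q .{{_ : ℕ.NonZero q}} k →
                     ∣ mobiusSum q (suc k) ℤ.- + (q ^ suc k) ∣ ≤ k * q ^ ⌊ suc k /2⌋
mobiusSum-estimate q k =
  subst (λ t → ∣ mobiusSum q (suc k) ℤ.- t ∣ ≤ k * q ^ ⌊ suc k /2⌋) (mobiusTerm-1 q (suc k))
        (sumDiv-dominated k (mobiusTerm q (suc k)) (∣mobiusTerm∣≤q^⌊n/2⌋ q (suc k)))

LeadingTermsDominate : ℕ → ℕ → Set
LeadingTermsDominate q n =
  suc n * (q ^ n + (n ℕ.∸ 1) * q ^ ⌊ n /2⌋) + n * (n * q ^ ⌈ n /2⌉) ≤ n * q ^ suc n

q^n≡q^⌊n/2⌋*q^⌈n/2⌉ : ∀ q n → q ^ n ≡ q ^ ⌊ n /2⌋ * q ^ ⌈ n /2⌉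
q^n≡q^⌊n/2⌋*q^⌈n/2⌉ q n =
  trans (cong (q ^_) (sym (ℕ.⌊n/2⌋+⌈n/2⌉≡n n))) (ℕ.^-distribˡ-+-* q ⌊ n /2⌋ ⌈ n /2⌉)

SplitDominate : ℕ → ℕ → ℕ → ℕ → Set
SplitDominate q k X Y = (2 + k) * (Y * X + k * Y) + suc k * (suc k * X) ≤ suc k * (q * (Y * X))

split-power : ∀ q k → SplitDominate q k (q ^ ⌈ suc k /2⌉) (q ^ ⌊ suc k /2⌋) → LeadingTermsDominate q (suc k)
split-power q k = subst (λ P → (2 + k) * (P + k * Y) + suc k * (suc k * X) ≤ suc k * (q * P))
                        (sym (q^n≡q^⌊n/2⌋*q^⌈n/2⌉ q (suc k)))
  where
  X = q ^ ⌈ suc k /2⌉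
  Y = q ^ ⌊ suc k /2⌋

3+n≤3*[1+n] : ∀ n → 3 + n ≤ 3 * suc n
3+n≤3*[1+n] n = begin
  3 + n          ≤⟨ ℕ.m≤m+n (3 + n) (2 * n) ⟩
  3 + n + 2 * n  ≡⟨ solve (n ∷ []) ⟩
  3 * suc n      ∎
  where open ℕ.≤-Reasoning

1+n≤3^⌈n/2⌉ : ∀ n → suc n ≤ 3 ^ ⌈ n /2⌉
1+n≤3^⌈n/2⌉ 0             = ℕ.≤-refl
1+n≤3^⌈n/2⌉ 1             = s≤s (s≤s z≤n)
1+n≤3^⌈n/2⌉ (suc (suc n)) = ℕ.≤-trans (3+n≤3*[1+n] n) (ℕ.*-monoʳ-≤ 3 (1+n≤3^⌈n/2⌉ n))

2n+3≤2^⌊n/2⌋ : ∀ n → 10 ≤ n → 2 * n + 3 ≤ 2 ^ ⌊ n /2⌋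
2n+3≤2^⌊n/2⌋ n 10≤n with ℕ.m≤n⇒∃[o]m+o≡n 10≤n
... | u , refl = from-10 u
  where
  from-10 : ∀ u → 2 * (10 + u) + 3 ≤ 2 ^ ⌊ 10 + u /2⌋
  from-10 0             = ℕ.m≤m+n 23 9
  from-10 1             = ℕ.m≤m+n 25 7
  from-10 (suc (suc u)) = begin
    2 * (12 + u) + 3                ≤⟨ ℕ.m≤m+n (2 * (12 + u) + 3) (19 + 2 * u) ⟩
    2 * (12 + u) + 3 + (19 + 2 * u) ≡⟨ solve (u ∷ []) ⟩
    2 * (2 * (10 + u) + 3)          ≤⟨ ℕ.*-monoʳ-≤ 2 (from-10 u) ⟩
    2 * 2 ^ ⌊ 10 + u /2⌋            ∎
    where open ℕ.≤-Reasoning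

splitDominate-≥3 : ∀ {q k X Y} → 3 ≤ q → 2 + k ≤ X → suc k ≤ Y → SplitDominate q k X Y
splitDominate-≥3 {q} {k} {X} {Y} 3≤q 2+k≤X 1+k≤Y = begin
  (2 + k) * (Y * X + k * Y) + suc k * (suc k * X)               ≡⟨ solve (k ∷ X ∷ Y ∷ []) ⟩
  (2 + k) * (Y * X) + k * ((2 + k) * Y) + suc k * (suc k * X)
    ≤⟨ ℕ.+-mono-≤ (ℕ.+-monoʳ-≤ ((2 + k) * (Y * X)) (ℕ.*-monoʳ-≤ k (ℕ.*-monoˡ-≤ Y 2+k≤X)))
                  (ℕ.*-monoʳ-≤ (suc k) (ℕ.*-monoˡ-≤ X 1+k≤Y)) ⟩
  (2 + k) * (Y * X) + k * (X * Y) + suc k * (Y * X)             ≡⟨ solve (k ∷ X ∷ Y ∷ []) ⟩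
  suc k * (3 * (Y * X))                                         ≤⟨ ℕ.*-monoʳ-≤ (suc k) (ℕ.*-monoˡ-≤ (Y * X) 3≤q) ⟩
  suc k * (q * (Y * X))                                         ∎
  where open ℕ.≤-Reasoning

splitDominate-2 : ∀ {k X Y} → 1 ≤ k → 2 * suc k + 3 ≤ Y → Y ≤ X → SplitDominate 2 k X Y
splitDominate-2 {k@(suc j)} {X} {Y} _ 2n+3≤Y Y≤X = begin
  (2 + k) * (Y * X + k * Y) + suc k * (suc k * X)               ≡⟨ solve (j ∷ X ∷ Y ∷ []) ⟩
  (2 + k) * (Y * X) + (k * (2 + k) * Y + suc k * suc k * X)
    ≤⟨ ℕ.+-monoʳ-≤ ((2 + k) * (Y * X)) (ℕ.+-monoˡ-≤ (suc k * suc k * X) (ℕ.*-monoʳ-≤ (k * (2 + k)) Y≤X)) ⟩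
  (2 + k) * (Y * X) + (k * (2 + k) * X + suc k * suc k * X)     ≡⟨ solve (j ∷ X ∷ []) ⟩
  (2 + k) * (Y * X) + (k * (2 + k) + suc k * suc k) * X
    ≤⟨ ℕ.+-monoʳ-≤ ((2 + k) * (Y * X)) (ℕ.*-monoˡ-≤ X coefficient) ⟩
  (2 + k) * (Y * X) + k * Y * X                                 ≡⟨ solve (j ∷ X ∷ Y ∷ []) ⟩
  suc k * (2 * (Y * X))                                         ∎
  where
  open ℕ.≤-Reasoning
  coefficient : k * (2 + k) + suc k * suc k ≤ k * Y
  coefficient = begin
    k * (2 + k) + suc k * suc k       ≤⟨ ℕ.m≤m+n (k * (2 + k) + suc k * suc k) j ⟩
    k * (2 + k) + suc k * suc k + j   ≡⟨ solve (j ∷ []) ⟩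
    k * (2 * suc k + 3)               ≤⟨ ℕ.*-monoʳ-≤ k 2n+3≤Y ⟩
    k * Y                             ∎

dominate-≥3 : ∀ {q} k → 3 ≤ q → LeadingTermsDominate q (suc k)
dominate-≥3 {q} k 3≤q = split-power q k (splitDominate-≥3 3≤q (1+n≤q^⌈n/2⌉ (suc k)) (1+n≤q^⌈n/2⌉ k))
  where
  1+n≤q^⌈n/2⌉ : ∀ n → suc n ≤ q ^ ⌈ n /2⌉
  1+n≤q^⌈n/2⌉ n = ℕ.≤-trans (1+n≤3^⌈n/2⌉ n) (ℕ.^-monoˡ-≤ ⌈ n /2⌉ 3≤q)

dominate-2 : ∀ n → 10 ≤ n → LeadingTermsDominate 2 n
dominate-2 1 (s≤s ())
dominate-2 n@(suc k@(suc _)) 10≤n =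
  split-power 2 k (splitDominate-2 (s≤s z≤n) (2n+3≤2^⌊n/2⌋ n 10≤n) (ℕ.^-monoʳ-≤ 2 (ℕ.⌊n/2⌋≤⌈n/2⌉ n)))

mobiusSum-ratio : ∀ q .{{_ : ℕ.NonZero q}} n .{{_ : ℕ.NonZero n}} → LeadingTermsDominate q n →
                  + suc n ℤ.* mobiusSum q n ≤ℤ + n ℤ.* mobiusSum q (suc n)
mobiusSum-ratio q n@(suc k) =
  cross-≤-from-estimates n (mobiusSum q n) (mobiusSum q (suc n)) (q ^ n) (q ^ suc n)
                         (mobiusSum-estimate q k) (mobiusSum-estimate q n)

I-mono-step : ∀ q .{{_ : ℕ.NonZero q}} k → LeadingTermsDominate q (2 + k) →
              I q (2 + k) ≤ℤ I q (3 + k)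
I-mono-step q k dominate = subst₂ _≤ℤ_ (sym (I≡mobiusSum/n q k)) (sym (I≡mobiusSum/n q (suc k)))
  (div≤div-suc (2 + k) (mobiusSum q (2 + k)) (mobiusSum q (3 + k)) (mobiusSum-ratio q (2 + k) dominate))

I₁≤I₂ : ∀ r → I (2 + r) 1 ≤ℤ I (2 + r) 2
I₁≤I₂ r = subst (I q 1 ≤ℤ_) (sym (I≡mobiusSum/n q 0))
  (i*d≤j⇒i≤j/d 2 {j = mobiusSum q 2} (+-cancelʳ-≤ (+ (1 * q ^ 1)) (begin
    + (1 + r) ℤ.* + 2 ℤ.+ + (1 * q ^ 1)  ≡⟨ cast ⟩
    + ((1 + r) * 2 + 1 * q ^ 1)          ≤⟨ +≤+ arithmetic ⟩
    + (q ^ 2)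
      ≤⟨ ∣i-j∣≤k⇒j≤i+k (mobiusSum q 2) (+ (q ^ 2)) (mobiusSum-estimate q 1) ⟩
    mobiusSum q 2 ℤ.+ + (1 * q ^ 1)      ∎)))
  where
  open ℤ.≤-Reasoning
  q = 2 + r
  -- q ^ 1 and q ^ 2 unfolded, so that the solver sees the variable r.
  arithmetic : (1 + r) * 2 + 1 * ((2 + r) * 1) ≤ (2 + r) * ((2 + r) * 1)
  arithmetic = ℕ.≤-trans (ℕ.m≤m+n _ (r + r * r)) (ℕ.≤-reflexive (solve (r ∷ [])))
  cast : + (1 + r) ℤ.* + 2 ℤ.+ + (1 * q ^ 1) ≡ + ((1 + r) * 2 + 1 * q ^ 1)
  cast = trans (cong (ℤ._+ + (1 * q ^ 1)) (sym (ℤ.pos-* (1 + r) 2)))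
               (sym (ℤ.pos-+ ((1 + r) * 2) (1 * q ^ 1)))

I₂-step-by-evaluation : ∀ k → {True (I 2 (2 + k) ℤ.≤? I 2 (3 + k))} → I 2 (2 + k) ≤ℤ I 2 (3 + k)
I₂-step-by-evaluation k {t} = toWitness t

I₂-mono : ∀ k → I 2 (2 + k) ≤ℤ I 2 (3 + k)
I₂-mono 0 = I₂-step-by-evaluation 0
I₂-mono 1 = I₂-step-by-evaluation 1
I₂-mono 2 = I₂-step-by-evaluation 2
I₂-mono 3 = I₂-step-by-evaluation 3
I₂-mono 4 = I₂-step-by-evaluation 4
I₂-mono 5 = I₂-step-by-evaluation 5
I₂-mono 6 = I₂-step-by-evaluation 6
I₂-mono 7 = I₂-step-by-evaluation 7
I₂-mono (suc (suc (suc (suc (suc (suc (suc (suc j)))))))) =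
  I-mono-step 2 (8 + j) (dominate-2 (10 + j) (ℕ.m≤m+n 10 j))

I-mono : ∀ q n → 2 ≤ q → 1 ≤ n → I q n ≤ℤ I q (suc n)
I-mono 0 n ()
I-mono 1 n (s≤s ())
I-mono (suc (suc r)) 0 _ ()
I-mono (suc (suc r)) 1 _ _ = I₁≤I₂ r
I-mono 2 (suc (suc k)) _ _ = I₂-mono k
I-mono q@(suc (suc (suc r))) (suc (suc k)) _ _ = I-mono-step q k (dominate-≥3 (suc k) (ℕ.m≤m+n 3 r))

prime-power⇒≥2 : ∀ {q} → IsPrimePower q → 2 ≤ q
prime-power⇒≥2 (p , zero  , _       , () , _)
prime-power⇒≥2 (p , suc k , p-prime , _  , refl) = ℕ.≤-trans (ℕ.nonTrivial⇒n>1 p) (ℕ.m≤m*n p (p ^ k))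
  where
  instance
    _ = prime⇒nonTrivial p-prime
    _ = prime⇒nonZero p-prime
    _ = ℕ.m^n≢0 p k

lemma3 : (q : ℕ) → IsPrimePower q → (m : ℕ) → 1 ≤ m → I q m ≤ℤ I q (suc m)
lemma3 q pq m = I-mono q m (prime-power⇒≥2 pq)
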